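{- For $m,r,s\in\mathbb{N}^*$ there is $\Psi(m,r,s)\in\mathbb{N}^*$ such that the following holds. Let $\mathbb{F}$ be a finite field and $I$ a finite set. If $F\subset\mathbb{F}$ with $0,1\in F$ has size at most $s$, $\mathbb{F}^*$ is $r$-coloured, $t\in\mathbb{F}^I$ is $F^{mr}$-independent, and $|I|\ge\Psi(m,r,s)$, then there is $t'\in\mathbb{F}^m$ such that $S(m,F;t')$ is monochromatic.
   Context: An $r$-colouring of $\mathbb{F}^*=\mathbb{F}\setminus\{0\}$ is a map $\mathbb{F}^*\to\{1,\dots,r\}$; a set is monochromatic if it is contained in a single colour class (in particular it avoids $0$). For $F\subset\mathbb{F}$ write $F^0:=\{1\}$ and $F^{i+1}:=F.F^i=\{fg:f\in F,g\in F^i\}$. For $E\subset\mathbb{F}$, $t=(t_i)_{i\in I}\in\mathbb{F}^I$ is $E$-independent if whenever $\sum_{i\in I}f_it_i=0$ with all $f_i\in E$, then $f_i=0$ for all $i$. For $t'=(t'_1,\dots,t'_m)\in\mathbb{F}^m$, with $F.x:=\{fx:f\in F\}$ and Minkowski sums, $S(m,F;t'):=\bigcup_{j=1}^m\left(t'_j+F.t'_{j+1}+\cdots+F.t'_m\right)$. -}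

module Defs where

open import Level using (0ℓ)
open import Data.Nat using (ℕ; zero; suc; _*_; _≤_)
open import Data.Fin using (Fin; _<_; _≤_)
import Data.Fin as Fin
open import Data.List using (List; length)
open import Data.List.Membership.Propositional using (_∈_)
open import Data.List.Relation.Unary.Unique.Propositional using (Unique)
open import Data.Product using (Σ; Σ-syntax; ∃; ∃-syntax; _×_; _,_)
open import Relation.Binary.PropositionalEquality using (_≡_; _≢_)
open import Algebra.Structures using (IsCommutativeRing)
open import Function.Bundles using (_↔_)

record FiniteField : Set₁ where
  infixl 7 _·_
  infixl 6 _⊕_
  field
    Carrier  : Set
    _⊕_ _·_  : Carrier → Carrier → Carrier
    ⊖_       : Carrier → Carrier
    𝟘 𝟙      : Carrier
    isCommutativeRing : IsCommutativeRing _≡_ _⊕_ _·_ ⊖_ 𝟘 𝟙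
    𝟘≢𝟙      : 𝟘 ≢ 𝟙
    inverse  : ∀ x → x ≢ 𝟘 → ∃[ y ] (x · y ≡ 𝟙)
    size     : ℕ
    finite   : Carrier ↔ Fin size

module _ (𝔽 : FiniteField) where
  open FiniteField 𝔽

  Σ[<_]_ : (k : ℕ) → (Fin k → Carrier) → Carrier
  Σ[< zero ] f = 𝟘
  Σ[< suc k ] f = f Fin.zero ⊕ Σ[< k ] (λ i → f (Fin.suc i))

  -- membership in the product set F^i, F given by a list of its elements
  -- F^0 = {1},  F^(i+1) = F.F^i
  InPow : List Carrier → ℕ → Carrier → Set
  InPow F zero x = x ≡ 𝟙
  InPow F (suc i) x = ∃[ f ] ∃[ g ] (f ∈ F × InPow F i g × x ≡ f · g)

  Independent : (E : Carrier → Set) → (k : ℕ) → (Fin k → Carrier) → Set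
  Independent E k t =
    (f : Fin k → Carrier) → (∀ i → E (f i)) →
    Σ[< k ] (λ i → f i · t i) ≡ 𝟘 → ∀ i → f i ≡ 𝟘

  -- x ∈ S(m,F;t') = ⋃_j ( t'_j + F.t'_{j+1} + ... + F.t'_m )
  InS : (m : ℕ) → List Carrier → (Fin m → Carrier) → Carrier → Set
  InS m F t' x =
    Σ[ j ∈ Fin m ] Σ[ f ∈ (Fin m → Carrier) ] ((∀ l → j < l → f l ∈ F) × (∀ l → l Fin.≤ j → f l ≡ 𝟘)
                   × x ≡ t' j ⊕ Σ[< m ] (λ l → f l · t' l))

  -- a set (predicate) is monochromatic for colouring c (only values on 𝔽* matter)
  Monochromatic : {r : ℕ} → (Carrier → Fin r) → (Carrier → Set) → Set
  Monochromatic {r} c S = ∃[ k ] (∀ x → S x → x ≢ 𝟘 × c x ≡ k)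

{-# OPTIONS --safe #-}
module Submission where

-- Extend c by a colour for 0 and pull it back to 𝔽ᵏ along W ↦ Σᵢ Wᵢ tᵢ. By colour focusing over the
-- multidimensional Hales–Jewett theorem (itself proved by colour focusing), every colouring of a large 𝔽ⁿ
-- has nonzero U₀, …, U_p all of whose levels U_j + Σ_{l>j} f_l U_l (f_l ∈ F) share one colour. A
-- monochromatic subspace over the alphabet Fᵉ yields an apex U₀ (1 on the first block, 0 on the others)
-- such that U₀ + w has the colour of U₀ for every w supported on the other blocks with entries in Fᵉ; the
-- induction on those blocks, with the quota of that colour lowered, returns either the same colour, which
-- U₀ then extends by one vector, or another colour. The coefficients stay in F^(r(m-1)+1) ⊆ F^(mr), so by
-- independence no level evaluates to 0, and the evaluations of U₀, …, U_{m-1} form t′.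

open import Defs
open import Level using (0ℓ)
open import Data.Nat
  using (ℕ; zero; suc; pred; _+_; _*_; _^_; _≤_; _<_; _≥_; _≤′_; ≤′-refl; ≤′-step; z≤n; s≤s; s≤s⁻¹; z<s; _<?_; NonZero)
open import Data.Nat.Properties
  using (≤⇒≤′; ≤-reflexive; n≤1+n; n<1+n; +-monoˡ-≤; *-comm; +-suc; ≤-trans; n≤0⇒n≡0; m≤m+n; m≤n+m)
open import Data.Fin as Fin
  using (Fin; zero; suc; toℕ; fromℕ<; inject≤; combine; quotient; remainder; funToFin; finToFun)
open import Data.Fin.Properties
  using (suc-injective; remQuot-combine; finToFun-funToFin; toℕ-injective; toℕ-fromℕ<; toℕ-inject≤; toℕ<n;
         pigeonhole; any?; <⇒≢)
open import Data.Vec as Vec using (Vec; []; _∷_; _++_; lookup; tabulate)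
open import Data.Vec.Properties using (map-++; map-∘; map-id; lookup-map; tabulate-cong; tabulate∘lookup)
open import Data.Vec.Membership.Propositional using () renaming (_∈_ to _∈ᵥ_)
open import Data.Vec.Membership.Propositional.Properties using (∈-++⁺ˡ; ∈-++⁺ʳ; ∈-map⁺)
open import Data.Vec.Relation.Unary.Any as VecAny using (here)
open import Data.Vec.Relation.Unary.Any.Properties using (lookup-index)
open import Data.Vec.Functional as Vector using (Vector; foldr; updateAt)
open import Data.Vec.Functional.Properties using (updateAt-updates; updateAt-minimal)
open import Data.List as List using (List; length)
open import Data.List.Membership.Propositional using (_∈_)
open import Data.List.Membership.Propositional.Properties using (∈-lookup)
import Data.List.Relation.Unary.Any as ListAny
import Data.List.Relation.Unary.Any.Properties as ListAnyProperties
open import Data.List.Relation.Unary.Unique.Propositional using (Unique)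
open import Data.Maybe as Maybe using (Maybe; just; nothing; maybe; fromMaybe)
open import Data.Product using (Σ-syntax; ∃-syntax; _×_; _,_; proj₁; proj₂)
open import Data.Sum using (_⊎_; inj₁; inj₂; [_,_]′)
open import Function using (id; _∘_; const)
open import Function.Definitions using (Injective)
open import Function.Properties.Inverse using (↔⇒↣)
open import Relation.Nullary using (Dec; yes; no; ¬_; contradiction)
open import Relation.Nullary.Decidable using (via-injection)
open import Relation.Binary.Core using (_Preserves_⟶_)
open import Relation.Binary.PropositionalEquality
open import Algebra.Bundles using (CommutativeRing)
open import Algebra.Structures using (IsCommutativeRing)
import Algebra.Properties.Semiring.Sum as SemiringSum

Root : ℕ → ℕ → Set
Root k n = Vec (Maybe (Fin k)) n

line : ∀ {k n} → Root k n → Fin k → Vec (Fin k) n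
line ρ a = Vec.map (fromMaybe a) ρ

line-++ : ∀ {k m n} (ρ : Root k m) (σ : Root k n) a → line (ρ ++ σ) a ≡ line ρ a ++ line σ a
line-++ ρ σ a = map-++ (fromMaybe a) ρ σ

line-just : ∀ {k n} (x : Vec (Fin k) n) a → line (Vec.map just x) a ≡ x
line-just x a = trans (sym (map-∘ (fromMaybe a) just x)) (map-id x)

line-just-++ : ∀ {k m n} (x : Vec (Fin k) m) (σ : Root k n) a → line (Vec.map just x ++ σ) a ≡ x ++ line σ a
line-just-++ x σ a = trans (line-++ _ σ a) (cong (_++ line σ a) (line-just x a))

line-++-just : ∀ {k m n} (ρ : Root k m) (x : Vec (Fin k) n) a → line (ρ ++ Vec.map just x) a ≡ line ρ a ++ x
line-++-just ρ x a = trans (line-++ ρ _ a) (cong (line ρ a ++_) (line-just x a))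

liftRoot : ∀ {k n} → Root k n → Root (suc k) n
liftRoot = Vec.map (Maybe.map suc)

line-liftRoot : ∀ {k n} (ρ : Root k n) a → line (liftRoot ρ) (suc a) ≡ Vec.map suc (line ρ a)
line-liftRoot []           a = refl
line-liftRoot (just x ∷ ρ) a = cong (suc x ∷_) (line-liftRoot ρ a)
line-liftRoot (nothing ∷ ρ) a = cong (suc a ∷_) (line-liftRoot ρ a)

record MonochromaticLine {k r n} (χ : Vec (Fin k) n → Fin r) : Set where
  field
    root     : Root k n
    active   : nothing ∈ᵥ root
    constant : ∀ a b → χ (line root a) ≡ χ (line root b)

HalesJewett : ℕ → ℕ → Set
HalesJewett k r = ∃[ n ] ∀ (χ : Vec (Fin k) n → Fin r) → MonochromaticLine χ

monochromaticLine-++ʳ : ∀ {k r m n} {χ : Vec (Fin k) (m + n) → Fin r} (x : Vec (Fin k) m) →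
                        MonochromaticLine (λ y → χ (x ++ y)) → MonochromaticLine χ
monochromaticLine-++ʳ {χ = χ} x L = record
  { root     = Vec.map just x ++ root
  ; active   = ∈-++⁺ʳ (Vec.map just x) active
  ; constant = λ a b → begin
      χ (line (Vec.map just x ++ root) a) ≡⟨ cong χ (line-just-++ x root a) ⟩
      χ (x ++ line root a)                ≡⟨ constant a b ⟩
      χ (x ++ line root b)                ≡⟨ cong χ (line-just-++ x root b) ⟨
      χ (line (Vec.map just x ++ root) b) ∎
  }
  where
  open MonochromaticLine L
  open ≡-Reasoning

-- A colouring by functions Vec (Fin l) n → Fin r is a colouring with r ^ (l ^ n) colours.
fibrewiseLine : ∀ {k l r m n} → (∀ (χ : Vec (Fin k) m → Fin (r ^ (l ^ n))) → MonochromaticLine χ) →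
                (Φ : Vec (Fin k) m → Vec (Fin l) n → Fin r) →
                Σ[ ρ ∈ Root k m ] nothing ∈ᵥ ρ × (∀ a b y → Φ (line ρ a) y ≡ Φ (line ρ b) y)
fibrewiseLine {l = l} {r} {n = n} hj Φ = root , active , fibre
  where
  code : _ → Fin (r ^ (l ^ n))
  code x = funToFin (λ c → Φ x (tabulate (finToFun c)))
  open MonochromaticLine (hj code)
  decode : ∀ x y → finToFun {r} {l ^ n} (code x) (funToFin (lookup y)) ≡ Φ x y
  decode x y = trans (finToFun-funToFin _ (funToFin (lookup y)))
                     (cong (Φ x) (trans (tabulate-cong (finToFun-funToFin (lookup y))) (tabulate∘lookup y)))
  fibre : ∀ a b y → Φ (line root a) y ≡ Φ (line root b) y
  fibre a b y = trans (sym (decode _ y))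
                      (trans (cong (λ c → finToFun c (funToFin (lookup y))) (constant a b)) (decode _ y))

-- The letters of Fin (suc K) are the old letters suc a and the new letter zero.
record Focused {K r} (q : ℕ) {n} (ψ : Vec (Fin (suc K)) n → Fin r) : Set where
  field
    focus            : Vec (Fin (suc K)) n
    roots            : Fin q → Root (suc K) n
    active           : ∀ i → nothing ∈ᵥ roots i
    focused          : ∀ i → line (roots i) zero ≡ focus
    colour           : Fin q → Fin r
    coloured         : ∀ i a → ψ (line (roots i) (suc a)) ≡ colour i
    colour-injective : Injective _≡_ _≡_ colour

focused-monochromaticLine : ∀ {K r q n} {ψ : Vec (Fin (suc K)) n → Fin r} (fc : Focused q ψ) i →
                            ψ (Focused.focus fc) ≡ Focused.colour fc i → MonochromaticLine ψ
focused-monochromaticLine {ψ = ψ} fc i ψfocus = record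
  { root = roots i ; active = active i ; constant = λ a b → trans (colour-i a) (sym (colour-i b)) }
  where
  open Focused fc
  colour-i : ∀ a → ψ (line (roots i) a) ≡ colour i
  colour-i zero    = trans (cong ψ (focused i)) ψfocus
  colour-i (suc a) = coloured i a

focused-extend : ∀ {K r q m n} {ψ : Vec (Fin (suc K)) (m + n) → Fin r} (z : Fin K) (ρ : Root (suc K) m) →
                 nothing ∈ᵥ ρ →
                 (∀ a b y → ψ (line ρ (suc a) ++ y) ≡ ψ (line ρ (suc b) ++ y)) →
                 (fc : Focused q (λ y → ψ (line ρ (suc z) ++ y))) →
                 (∀ i → ψ (line ρ (suc z) ++ Focused.focus fc) ≢ Focused.colour fc i) →
                 Focused (suc q) ψ
focused-extend {ψ = ψ} z ρ ρ-active ρ-fibre fc new = record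
  { focus            = line ρ zero ++ focus
  ; roots            = roots′
  ; active           = λ { zero → ∈-++⁺ˡ ρ-active ; (suc i) → ∈-++⁺ˡ ρ-active }
  ; focused          = focused′
  ; colour           = colour′
  ; coloured         = coloured′
  ; colour-injective = injective′
  }
  where
  open Focused fc
  roots′ : Fin (suc _) → Root _ _
  roots′ zero    = ρ ++ Vec.map just focus
  roots′ (suc i) = ρ ++ roots i
  focused′ : ∀ i → line (roots′ i) zero ≡ line ρ zero ++ focus
  focused′ zero    = line-++-just ρ focus zero
  focused′ (suc i) = trans (line-++ ρ _ zero) (cong (line ρ zero ++_) (focused i))
  colour′ : Fin (suc _) → Fin _
  colour′ zero    = ψ (line ρ (suc z) ++ focus)
  colour′ (suc i) = colour i
  coloured′ : ∀ i a → ψ (line (roots′ i) (suc a)) ≡ colour′ i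
  coloured′ zero    a = trans (cong ψ (line-++-just ρ focus (suc a))) (ρ-fibre a z focus)
  coloured′ (suc i) a = trans (cong ψ (line-++ ρ _ (suc a))) (trans (ρ-fibre a z _) (coloured i a))
  injective′ : Injective _≡_ _≡_ colour′
  injective′ {zero}  {zero}  _ = refl
  injective′ {zero}  {suc j} e = contradiction e (new j)
  injective′ {suc i} {zero}  e = contradiction (sym e) (new i)
  injective′ {suc i} {suc j} e = cong suc (colour-injective e)

focusing : ∀ {K} → Fin K → (∀ r → HalesJewett K r) → ∀ r q →
           ∃[ n ] ∀ (ψ : Vec (Fin (suc K)) n → Fin r) → MonochromaticLine ψ ⊎ Focused q ψ
focusing z hj r zero = 0 , λ ψ → inj₂ record
  { focus = [] ; roots = λ () ; active = λ () ; focused = λ ()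
  ; colour = λ () ; coloured = λ () ; colour-injective = λ {} }
focusing {K} z hj r (suc q) = m + n , step
  where
  n = proj₁ (focusing z hj r q)
  m = proj₁ (hj (r ^ (suc K ^ n)))
  step : ∀ ψ → MonochromaticLine ψ ⊎ Focused (suc q) ψ
  step ψ = extend (proj₂ (focusing z hj r q) (λ y → ψ (x₀ ++ y)))
    where
    fibred = fibrewiseLine (proj₂ (hj (r ^ (suc K ^ n)))) (λ x y → ψ (Vec.map suc x ++ y))
    ρ = liftRoot (proj₁ fibred)
    ρ-fibre : ∀ a b y → ψ (line ρ (suc a) ++ y) ≡ ψ (line ρ (suc b) ++ y)
    ρ-fibre a b y rewrite line-liftRoot (proj₁ fibred) a | line-liftRoot (proj₁ fibred) b =
      proj₂ (proj₂ fibred) a b y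
    x₀ = line ρ (suc z)
    extend : MonochromaticLine (λ y → ψ (x₀ ++ y)) ⊎ Focused q (λ y → ψ (x₀ ++ y)) →
             MonochromaticLine ψ ⊎ Focused (suc q) ψ
    extend (inj₁ L)  = inj₁ (monochromaticLine-++ʳ x₀ L)
    extend (inj₂ fc) with any? (λ i → ψ (x₀ ++ Focused.focus fc) Fin.≟ Focused.colour fc i)
    ... | yes (i , e) = inj₁ (monochromaticLine-++ʳ x₀ (focused-monochromaticLine fc i e))
    ... | no  none    = inj₂ (focused-extend z ρ (∈-map⁺ _ (proj₁ (proj₂ fibred))) ρ-fibre fc
                                             (λ i e → none (i , e)))

halesJewett-suc : ∀ {K} → Fin K → (∀ r → HalesJewett K r) → ∀ r → HalesJewett (suc K) r
halesJewett-suc {K} z hj r with focusing z hj r (suc r)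
... | n , line-or-focused = n , λ ψ → [ id , unfocused ]′ (line-or-focused ψ)
  where
  unfocused : ∀ {n} {ψ : Vec (Fin (suc K)) n → Fin r} → Focused (suc r) ψ → MonochromaticLine ψ
  unfocused fc with pigeonhole (n<1+n r) (Focused.colour fc)
  ... | i , j , i<j , e = contradiction (Focused.colour-injective fc e) (<⇒≢ i<j)

halesJewett : ∀ k r → HalesJewett k r
halesJewett zero          r = 1 , λ χ → record
  { root = nothing ∷ [] ; active = here refl ; constant = λ () }
halesJewett (suc zero)    r = 1 , λ χ → record
  { root = nothing ∷ [] ; active = here refl ; constant = λ { zero zero → refl } }
halesJewett (suc (suc k))   = halesJewett-suc zero (halesJewett (suc k))

hjNumber : ℕ → ℕ → ℕ
hjNumber k r = proj₁ (halesJewett k r)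

record Enumeration {X : Set} (L : ℕ) (P : X → Set) : Set where
  field
    enum      : Fin L → X
    enum-∈    : ∀ c → P (enum c)
    enum-onto : ∀ {x} → P x → ∃[ c ] enum c ≡ x

substitute : ∀ {X : Set} {n D} → (Fin n → X ⊎ Fin D) → (Fin D → X) → Fin n → X
substitute τ a i = [ id , a ]′ (τ i)

record MonochromaticSubspace {X : Set} {n r} (P : X → Set) (D : ℕ) (χ : (Fin n → X) → Fin r) : Set where
  field
    template : Fin n → X ⊎ Fin D
    fixed-∈  : ∀ {i x} → template i ≡ inj₁ x → P x
    block    : ∀ d → ∃[ i ] template i ≡ inj₂ d
    constant : ∀ {a b} → (∀ d → P (a d)) → (∀ d → P (b d)) →
               χ (substitute template a) ≡ χ (substitute template b)

substitute-∈ : ∀ {X : Set} {P : X → Set} {n r D} {χ : (Fin n → X) → Fin r} (S : MonochromaticSubspace P D χ) →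
               ∀ {a} → (∀ d → P (a d)) → ∀ i → P (substitute (MonochromaticSubspace.template S) a i)
substitute-∈ {P = P} S {a} a∈P i = at (template i) (fixed-∈ {i})
  where
  open MonochromaticSubspace S
  at : ∀ v → (∀ {x} → v ≡ inj₁ x → P x) → P ([ id , a ]′ v)
  at (inj₁ x) fixed = fixed refl
  at (inj₂ d) _     = a∈P d

mdhjNumber : ℕ → ℕ → ℕ → ℕ
mdhjNumber L D r = hjNumber (L ^ D) r * D

-- A word over the alphabet Fin (L ^ D) of length N is read as a word over Fin L of length N * D
-- made of N blocks of length D; a combinatorial line then varies whole blocks, i.e. it is a
-- D-dimensional subspace.
multidimensionalHalesJewett : ∀ {X : Set} {P : X → Set} {L} → Enumeration L P → ∀ D r
                              (χ : (Fin (mdhjNumber L D r) → X) → Fin r) → χ Preserves _≗_ ⟶ _≡_ →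
                              MonochromaticSubspace P D χ
multidimensionalHalesJewett {X = X} {P} {L} E D r χ χ-cong = record
  { template = template
  ; fixed-∈  = λ {i} → fixed-∈ (lookup root (quotient {N} D i)) (remainder {N} D i)
  ; block    = block
  ; constant = λ {a} {b} a∈P b∈P → trans (χ-cong (substitute-line a∈P))
      (trans (constant (code {a} a∈P) (code {b} b∈P)) (sym (χ-cong (substitute-line b∈P))))
  }
  where
  open Enumeration E
  N = hjNumber (L ^ D) r
  letter : Fin (L ^ D) → Fin D → X
  letter c d = enum (finToFun c d)
  word : Vec (Fin (L ^ D)) N → Fin (N * D) → X
  word x i = letter (lookup x (quotient {N} D i)) (remainder {N} D i)
  open MonochromaticLine (proj₂ (halesJewett (L ^ D) r) (χ ∘ word))
  templateAt : Maybe (Fin (L ^ D)) → Fin D → X ⊎ Fin D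
  templateAt nothing  d = inj₂ d
  templateAt (just c) d = inj₁ (letter c d)
  template : Fin (N * D) → X ⊎ Fin D
  template i = templateAt (lookup root (quotient {N} D i)) (remainder {N} D i)
  fixed-∈ : ∀ m d {x} → templateAt m d ≡ inj₁ x → P x
  fixed-∈ (just c) d refl = enum-∈ _
  block : ∀ d → ∃[ i ] template i ≡ inj₂ d
  block d = combine i₀ d ,
            trans (cong (λ (b , d′) → templateAt (lookup root b) d′) (remQuot-combine {k = D} i₀ d))
                  (cong (λ m → templateAt m d) (sym (lookup-index active)))
    where i₀ = VecAny.index active
  code : ∀ {a} → (∀ d → P (a d)) → Fin (L ^ D)
  code {a} a∈P = funToFin {D} {L} (λ d → proj₁ (enum-onto {a d} (a∈P d)))
  letter-code : ∀ {a} (a∈P : ∀ d → P (a d)) d → letter (code {a} a∈P) d ≡ a d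
  letter-code {a} a∈P d = trans (cong enum (finToFun-funToFin (λ d → proj₁ (enum-onto {a d} (a∈P d))) d))
                                (proj₂ (enum-onto (a∈P d)))
  substitute-line : ∀ {a} (a∈P : ∀ d → P (a d)) → substitute template a ≗ word (line root (code {a} a∈P))
  substitute-line {a} a∈P i =
    trans (substituteAt (lookup root b) d)
          (cong (λ c → letter c d) (sym (lookup-map b (fromMaybe (code {a} a∈P)) root)))
    where
    b = quotient {N} D i
    d = remainder {N} D i
    substituteAt : ∀ m d → [ id , a ]′ (templateAt m d) ≡ letter (fromMaybe (code {a} a∈P) m) d
    substituteAt nothing  d = sym (letter-code a∈P d)
    substituteAt (just c) d = refl

inject≤⁻¹ : ∀ {k} n → Fin k → Maybe (Fin n)
inject≤⁻¹ n i with toℕ i <? n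
... | yes i<n = just (fromℕ< i<n)
... | no  _   = nothing

inject≤⁻¹-inject≤ : ∀ {n k} (i : Fin n) (n≤k : n ≤ k) → inject≤⁻¹ n (inject≤ i n≤k) ≡ just i
inject≤⁻¹-inject≤ {n} i n≤k with toℕ (inject≤ i n≤k) <? n
... | yes lt  = cong just (toℕ-injective (trans (toℕ-fromℕ< lt) (toℕ-inject≤ i n≤k)))
... | no  ¬lt = contradiction (subst (_< n) (sym (toℕ-inject≤ i n≤k)) (toℕ<n i)) ¬lt

enumerate-∈ : ∀ {X : Set} {xs : List X} {x₀ s} → x₀ ∈ xs → length xs ≤ s → Enumeration s (_∈ xs)
enumerate-∈ {X = X} {xs} {x₀} x₀∈xs |xs|≤s = record
  { enum      = entry ∘ inject≤⁻¹ (length xs)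
  ; enum-∈    = entry-∈ ∘ inject≤⁻¹ (length xs)
  ; enum-onto = λ x∈xs → inject≤ (ListAny.index x∈xs) |xs|≤s
                       , trans (cong entry (inject≤⁻¹-inject≤ _ |xs|≤s)) (sym (ListAnyProperties.lookup-index x∈xs))
  }
  where
  entry : Maybe (Fin (length xs)) → X
  entry = maybe (List.lookup xs) x₀
  entry-∈ : ∀ m → entry m ∈ xs
  entry-∈ nothing  = x₀∈xs
  entry-∈ (just i) = ∈-lookup i

total : ∀ {R} → Vector ℕ R → ℕ
total = foldr _+_ 0

total-updateAt-pred : ∀ {R} (q : Vector ℕ R) κ {p} → q κ ≡ suc p → total q ≡ suc (total (updateAt q κ pred))
total-updateAt-pred q zero    qκ≡ rewrite qκ≡ = refl
total-updateAt-pred q (suc κ) qκ≡ =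
  trans (cong (q zero +_) (total-updateAt-pred (q ∘ suc) κ qκ≡)) (+-suc (q zero) _)

lookup≤total : ∀ {R} (q : Vector ℕ R) κ → q κ ≤ total q
lookup≤total q zero    = m≤m+n (q zero) _
lookup≤total q (suc κ) = ≤-trans (lookup≤total (q ∘ suc) κ) (m≤n+m _ (q zero))

total-const : ∀ R x → total {R} (const x) ≡ R * x
total-const zero    x = refl
total-const (suc R) x = cong (x +_) (total-const R x)

monochromaticSNumber : ℕ → ℕ → ℕ → ℕ
monochromaticSNumber s zero    R = 1
monochromaticSNumber s (suc T) R = mdhjNumber (s ^ suc T) (suc (monochromaticSNumber s T R)) R

module _ (𝔽 : FiniteField) where
  open FiniteField 𝔽
  open IsCommutativeRing isCommutativeRing
    using (+-identityˡ; +-identityʳ; zeroˡ; zeroʳ; *-identityˡ; *-assoc; distribʳ)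

  commutativeRing : CommutativeRing 0ℓ 0ℓ
  commutativeRing = record
    { Carrier = Carrier ; _≈_ = _≡_ ; _+_ = _⊕_ ; _*_ = _·_ ; -_ = ⊖_ ; 0# = 𝟘 ; 1# = 𝟙
    ; isCommutativeRing = isCommutativeRing }

  open SemiringSum (CommutativeRing.semiring commutativeRing)
    using (sum; sum-cong-≗; sum-replicate-zero; ∑-distrib-+; ∑-comm; *-distribˡ-sum; *-distribʳ-sum)

  Σ[<]-sum : ∀ k (f : Vector Carrier k) → Σ[<_]_ 𝔽 k f ≡ sum f
  Σ[<]-sum zero    f = refl
  Σ[<]-sum (suc k) f = cong (f zero ⊕_) (Σ[<]-sum k (f ∘ suc))

  sum-𝟘 : ∀ {p} {f : Vector Carrier p} → f ≗ const 𝟘 → sum f ≡ 𝟘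
  sum-𝟘 {p} f≗𝟘 = trans (sum-cong-≗ f≗𝟘) (sum-replicate-zero p)

  𝟙≢𝟘 : 𝟙 ≢ 𝟘
  𝟙≢𝟘 = 𝟘≢𝟙 ∘ sym

  _≟_ : (x y : Carrier) → Dec (x ≡ y)
  _≟_ = via-injection (↔⇒↣ finite) Fin._≟_

  combination : ∀ {p n} → Vector Carrier p → (Fin p → Vector Carrier n) → Vector Carrier n
  combination f U i = sum (λ l → f l · U l i)

  level : ∀ {p n} → (Fin p → Vector Carrier n) → Fin p → Vector Carrier p → Vector Carrier n
  level U j f i = U j i ⊕ combination f U i

  combination-𝟘 : ∀ {p n} (U : Fin p → Vector Carrier n) → combination (const 𝟘) U ≗ const 𝟘
  combination-𝟘 U i = sum-𝟘 (λ l → zeroˡ (U l i))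

  combination-tail : ∀ {p n} (f : Vector Carrier (suc p)) (U : Fin (suc p) → Vector Carrier n) →
                     f zero ≡ 𝟘 → combination f U ≗ combination (f ∘ suc) (U ∘ suc)
  combination-tail f U f₀≡𝟘 i =
    trans (cong (λ x → x · U zero i ⊕ rest) f₀≡𝟘) (trans (cong (_⊕ rest) (zeroˡ _)) (+-identityˡ rest))
    where rest = combination (f ∘ suc) (U ∘ suc) i

  embed : ∀ {n n′} → (Fin n → Maybe (Fin n′)) → Vector Carrier n′ → Vector Carrier n
  embed π y i = maybe y 𝟘 (π i)

  embed-cong : ∀ {n n′} (π : Fin n → Maybe (Fin n′)) {x y} → x ≗ y → embed π x ≗ embed π y
  embed-cong π x≗y i with π i
  ... | nothing = refl
  ... | just i′ = x≗y i′

  embed-⊕ : ∀ {n n′} (π : Fin n → Maybe (Fin n′)) x y i →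
            embed π x i ⊕ embed π y i ≡ embed π (λ i′ → x i′ ⊕ y i′) i
  embed-⊕ π x y i with π i
  ... | nothing = +-identityˡ 𝟘
  ... | just i′ = refl

  combination-embed : ∀ {p n n′} (π : Fin n → Maybe (Fin n′)) f (U : Fin p → Vector Carrier n′) →
                      combination f (embed π ∘ U) ≗ embed π (combination f U)
  combination-embed π f U i with π i
  ... | nothing = sum-𝟘 (λ l → zeroʳ (f l))
  ... | just i′ = refl

  level-embed : ∀ {p n n′} (π : Fin n → Maybe (Fin n′)) (U : Fin p → Vector Carrier n′) j f →
                level (embed π ∘ U) j f ≗ embed π (level U j f)
  level-embed π U j f i = trans (cong (embed π (U j) i ⊕_) (combination-embed π f U i)) (embed-⊕ π _ _ i)

  embed-nonzero : ∀ {n n′} (π : Fin n → Maybe (Fin n′)) → (∀ i′ → ∃[ i ] π i ≡ just i′) →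
                  ∀ {y} → ∃[ i′ ] y i′ ≢ 𝟘 → ∃[ i ] embed π y i ≢ 𝟘
  embed-nonzero π onto {y} (i′ , yi′≢𝟘) with onto i′
  ... | i , πi≡ = i , λ embed≡𝟘 → yi′≢𝟘 (trans (sym (cong (maybe y 𝟘) πi≡)) embed≡𝟘)

  module _ {k} (t : Vector Carrier k) where
    evaluate : Vector Carrier k → Carrier
    evaluate W = sum (λ i → W i · t i)

    evaluate-cong : ∀ {W W′} → W ≗ W′ → evaluate W ≡ evaluate W′
    evaluate-cong W≗W′ = sum-cong-≗ (λ i → cong (_· t i) (W≗W′ i))

    evaluate-level : ∀ {p} (U : Fin p → Vector Carrier k) j f →
                     evaluate (level U j f) ≡ evaluate (U j) ⊕ sum (λ l → f l · evaluate (U l))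
    evaluate-level U j f = begin
      sum (λ i → (U j i ⊕ combination f U i) · t i)
        ≡⟨ sum-cong-≗ (λ i → distribʳ (t i) (U j i) (combination f U i)) ⟩
      sum (λ i → U j i · t i ⊕ combination f U i · t i)
        ≡⟨ ∑-distrib-+ (λ i → U j i · t i) (λ i → combination f U i · t i) ⟩
      evaluate (U j) ⊕ sum (λ i → combination f U i · t i)
        ≡⟨ cong (evaluate (U j) ⊕_) (sum-cong-≗ (λ i → *-distribʳ-sum (t i) (λ l → f l · U l i))) ⟩
      evaluate (U j) ⊕ sum (λ i → sum (λ l → f l · U l i · t i))
        ≡⟨ cong (evaluate (U j) ⊕_) (∑-comm (λ i l → f l · U l i · t i)) ⟩
      evaluate (U j) ⊕ sum (λ l → sum (λ i → f l · U l i · t i))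
        ≡⟨ cong (evaluate (U j) ⊕_) (sum-cong-≗ pull-out) ⟩
      evaluate (U j) ⊕ sum (λ l → f l · evaluate (U l)) ∎
      where
      open ≡-Reasoning
      pull-out : ∀ l → sum (λ i → f l · U l i · t i) ≡ f l · evaluate (U l)
      pull-out l = trans (sum-cong-≗ (λ i → *-assoc (f l) (U l i) (t i)))
                         (sym (*-distribˡ-sum (f l) (λ i → U l i · t i)))

  module _ {r} (c : Carrier → Fin r) where
    colour₀ : Carrier → Fin (suc r)
    colour₀ x with x ≟ 𝟘
    ... | yes _ = zero
    ... | no  _ = suc (c x)

    colour₀-zero : ∀ x → colour₀ x ≡ zero → x ≡ 𝟘
    colour₀-zero x with x ≟ 𝟘
    ... | yes x≡𝟘 = λ _ → x≡𝟘
    ... | no  _   = λ ()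

    colour₀-suc : ∀ x {κ} → colour₀ x ≡ suc κ → x ≢ 𝟘 × c x ≡ κ
    colour₀-suc x with x ≟ 𝟘
    ... | yes _   = λ ()
    ... | no  x≢𝟘 = λ c≡ → x≢𝟘 , suc-injective c≡

  module _ {F : List Carrier} (0∈F : 𝟘 ∈ F) (1∈F : 𝟙 ∈ F) where
    InPow-· : ∀ {e f x} → f ∈ F → InPow 𝔽 F e x → InPow 𝔽 F (suc e) (f · x)
    InPow-· {f = f} {x} f∈F x∈Fᵉ = f , x , f∈F , x∈Fᵉ , refl

    InPow-𝟙 : ∀ e → InPow 𝔽 F e 𝟙
    InPow-𝟙 zero    = refl
    InPow-𝟙 (suc e) = subst (InPow 𝔽 F (suc e)) (*-identityˡ 𝟙) (InPow-· 1∈F (InPow-𝟙 e))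

    InPow-𝟘 : ∀ e → InPow 𝔽 F (suc e) 𝟘
    InPow-𝟘 e = subst (InPow 𝔽 F (suc e)) (zeroˡ 𝟙) (InPow-· 0∈F (InPow-𝟙 e))

    InPow-suc : ∀ {e x} → InPow 𝔽 F e x → InPow 𝔽 F (suc e) x
    InPow-suc {e} {x} x∈Fᵉ = subst (InPow 𝔽 F (suc e)) (*-identityˡ x) (InPow-· 1∈F x∈Fᵉ)

    InPow-mono : ∀ {e e′ x} → e ≤′ e′ → InPow 𝔽 F e x → InPow 𝔽 F e′ x
    InPow-mono ≤′-refl        x∈Fᵉ = x∈Fᵉ
    InPow-mono (≤′-step e≤e′) x∈Fᵉ = InPow-suc (InPow-mono e≤e′ x∈Fᵉ)

    enumerate-InPow : ∀ {s} → Enumeration s (_∈ F) → ∀ e → Enumeration (s ^ e) (InPow 𝔽 F e)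
    enumerate-InPow E zero = record
      { enum = const 𝟙 ; enum-∈ = const refl ; enum-onto = λ { refl → zero , refl } }
    enumerate-InPow {s} E (suc e) = record
      { enum      = enum
      ; enum-∈    = λ c → InPow-· (E₁.enum-∈ _) (Eₑ.enum-∈ _)
      ; enum-onto = onto
      }
      where
      module E₁ = Enumeration E
      module Eₑ = Enumeration (enumerate-InPow E e)
      enum : Fin (s ^ suc e) → Carrier
      enum c = E₁.enum (quotient (s ^ e) c) · Eₑ.enum (remainder {s} (s ^ e) c)
      onto : ∀ {x} → InPow 𝔽 F (suc e) x → ∃[ c ] enum c ≡ x
      onto (f , g , f∈F , g∈Fᵉ , refl) with E₁.enum-onto f∈F | Eₑ.enum-onto g∈Fᵉ
      ... | a , refl | b , refl =
        combine a b , cong (λ (a′ , b′) → E₁.enum a′ · Eₑ.enum b′) (remQuot-combine {k = s ^ e} a b)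

    Admissible : ∀ {p} → Fin p → Vector Carrier p → Set
    Admissible j f = (∀ l → j Fin.< l → f l ∈ F) × (∀ l → l Fin.≤ j → f l ≡ 𝟘)

    -- U spans a κ-coloured copy of S(p + 1, F; ·) in 𝔽ⁿ whose F-combinations have coordinates in Fᵉ.
    record MonochromaticS {n r} (χ : Vector Carrier n → Fin r) (e : ℕ) (κ : Fin r) (p : ℕ) : Set where
      field
        U              : Fin (suc p) → Vector Carrier n
        combination-∈  : ∀ f → (∀ l → f l ∈ F) → ∀ i → InPow 𝔽 F e (combination f U i)
        nonzero        : ∀ j → ∃[ i ] U j i ≢ 𝟘
        level-coloured : ∀ j f → Admissible j f → χ (level U j f) ≡ κ

    MonochromaticS-singleton : ∀ {n r e} {χ : Vector Carrier n → Fin r} → χ Preserves _≗_ ⟶ _≡_ →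
                               (u : Vector Carrier n) → (∀ i → InPow 𝔽 F e (u i)) → ∃[ i ] u i ≢ 𝟘 →
                               MonochromaticS χ (suc e) (χ u) 0
    MonochromaticS-singleton χ-cong u u∈Fᵉ u≢𝟘 = record
      { U              = const u
      ; combination-∈  = λ f f∈F i → subst (InPow 𝔽 F _) (sym (+-identityʳ _)) (InPow-· (f∈F zero) (u∈Fᵉ i))
      ; nonzero        = const u≢𝟘
      ; level-coloured = λ { zero f (_ , f≡𝟘) → χ-cong (λ i →
          trans (cong (u i ⊕_) (combination-tail f (const u) (f≡𝟘 zero z≤n) i)) (+-identityʳ (u i))) }
      }

    MonochromaticS-raise : ∀ {n r e κ p} {χ : Vector Carrier n → Fin r} →
                           MonochromaticS χ e κ p → MonochromaticS χ (suc e) κ p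
    MonochromaticS-raise M = record
      { U = U ; combination-∈ = λ f f∈F i → InPow-suc (combination-∈ f f∈F i)
      ; nonzero = nonzero ; level-coloured = level-coloured }
      where open MonochromaticS M

    MonochromaticS-pullback : ∀ {n n′ r e κ p} {χ : Vector Carrier n → Fin r} (π : Fin n → Maybe (Fin n′)) →
                              (∀ i′ → ∃[ i ] π i ≡ just i′) → χ Preserves _≗_ ⟶ _≡_ →
                              MonochromaticS (χ ∘ embed π) (suc e) κ p → MonochromaticS χ (suc e) κ p
    MonochromaticS-pullback {e = e} π onto χ-cong M = record
      { U              = embed π ∘ U
      ; combination-∈  = λ f f∈F i →
          subst (InPow 𝔽 F (suc e)) (sym (combination-embed π f U i)) (embed-∈ (combination-∈ f f∈F) i)
      ; nonzero        = λ j → embed-nonzero π onto (nonzero j)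
      ; level-coloured = λ j f adm → trans (χ-cong (level-embed π U j f)) (level-coloured j f adm)
      }
      where
      open MonochromaticS M
      embed-∈ : ∀ {y} → (∀ i′ → InPow 𝔽 F (suc e) (y i′)) → ∀ i → InPow 𝔽 F (suc e) (embed π y i)
      embed-∈ y∈Fᵉ i with π i
      ... | nothing = InPow-𝟘 e
      ... | just i′ = y∈Fᵉ i′

    module Apex {n n′ r e} {χ : Vector Carrier n → Fin r}
                (S : MonochromaticSubspace (InPow 𝔽 F (suc e)) (suc n′) χ) where
      open MonochromaticSubspace S

      apex : Vector Carrier n
      apex = substitute template (𝟙 Vector.∷ const 𝟘)

      laterBlock : Carrier ⊎ Fin (suc n′) → Maybe (Fin n′)
      laterBlock (inj₁ _)       = nothing
      laterBlock (inj₂ zero)    = nothing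
      laterBlock (inj₂ (suc d)) = just d

      shift : Fin n → Maybe (Fin n′)
      shift = laterBlock ∘ template

      lift : Vector Carrier n′ → Vector Carrier n
      lift = embed shift

      lift-onto : ∀ d → ∃[ i ] shift i ≡ just d
      lift-onto d with block (suc d)
      ... | i , template-i = i , cong laterBlock template-i

      𝟙∷-∈ : ∀ {y : Vector Carrier n′} → (∀ d → InPow 𝔽 F (suc e) (y d)) →
             ∀ d → InPow 𝔽 F (suc e) ((𝟙 Vector.∷ y) d)
      𝟙∷-∈ y∈Fᵉ zero    = InPow-𝟙 (suc e)
      𝟙∷-∈ y∈Fᵉ (suc d) = y∈Fᵉ d

      apex-∈ : ∀ i → InPow 𝔽 F (suc e) (apex i)
      apex-∈ = substitute-∈ S (𝟙∷-∈ (λ _ → InPow-𝟘 e))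

      apex-nonzero : ∃[ i ] apex i ≢ 𝟘
      apex-nonzero with block zero
      ... | i , template-i = i , λ apex≡𝟘 → 𝟙≢𝟘 (trans (sym (cong [ id , 𝟙 Vector.∷ const 𝟘 ]′ template-i)) apex≡𝟘)

      substitute-𝟙∷ : ∀ y → substitute template (𝟙 Vector.∷ y) ≗ (λ i → apex i ⊕ lift y i)
      substitute-𝟙∷ y i = at (template i)
        where
        at : ∀ v → [ id , 𝟙 Vector.∷ y ]′ v ≡ [ id , 𝟙 Vector.∷ const 𝟘 ]′ v ⊕ maybe y 𝟘 (laterBlock v)
        at (inj₁ x)       = sym (+-identityʳ x)
        at (inj₂ zero)    = sym (+-identityʳ 𝟙)
        at (inj₂ (suc d)) = sym (+-identityˡ (y d))

      -- apex and lift y have disjoint supports, so no sum of two elements of Fᵉ arises.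
      apex-lift-∈ : ∀ {f y} → f ∈ F → (∀ d → InPow 𝔽 F (suc e) (y d)) →
                    ∀ i → InPow 𝔽 F (suc (suc e)) (f · apex i ⊕ lift y i)
      apex-lift-∈ {f} {y} f∈F y∈Fᵉ i = at (template i) (fixed-∈ {i})
        where
        at : ∀ v → (∀ {x} → v ≡ inj₁ x → InPow 𝔽 F (suc e) x) →
             InPow 𝔽 F (suc (suc e)) (f · [ id , 𝟙 Vector.∷ const 𝟘 ]′ v ⊕ maybe y 𝟘 (laterBlock v))
        at (inj₁ x)       fixed = subst (InPow 𝔽 F _) (sym (+-identityʳ _)) (InPow-· f∈F (fixed refl))
        at (inj₂ zero)    _     = subst (InPow 𝔽 F _) (sym (+-identityʳ _)) (InPow-· f∈F (InPow-𝟙 (suc e)))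
        at (inj₂ (suc d)) _     =
          subst (InPow 𝔽 F _) (sym (trans (cong (_⊕ y d) (zeroʳ f)) (+-identityˡ (y d)))) (InPow-suc (y∈Fᵉ d))

      MonochromaticS-extend : ∀ {p} → χ Preserves _≗_ ⟶ _≡_ →
                              MonochromaticS (χ ∘ lift) (suc e) (χ apex) p →
                              MonochromaticS χ (suc (suc e)) (χ apex) (suc p)
      MonochromaticS-extend {p} χ-cong M = record
        { U              = U′
        ; combination-∈  = λ f f∈F i →
            subst (InPow 𝔽 F _) (sym (cong (f zero · apex i ⊕_) (combination-embed shift (f ∘ suc) U i)))
                  (apex-lift-∈ (f∈F zero) (combination-∈ (f ∘ suc) (f∈F ∘ suc)) i)
        ; nonzero        = λ { zero → apex-nonzero ; (suc j) → embed-nonzero shift lift-onto (nonzero j) }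
        ; level-coloured = coloured
        }
        where
        open MonochromaticS M
        U′ : Fin (suc (suc p)) → Vector Carrier n
        U′ zero    = apex
        U′ (suc l) = lift (U l)
        coloured : ∀ j f → Admissible j f → χ (level U′ j f) ≡ χ apex
        coloured zero f (f∈F , f≡𝟘) = begin
          χ (level U′ zero f)                          ≡⟨ χ-cong level-substitute ⟩
          χ (substitute template (𝟙 Vector.∷ c))       ≡⟨ constant (𝟙∷-∈ c∈Fᵉ) (𝟙∷-∈ (λ _ → InPow-𝟘 e)) ⟩
          χ (substitute template (𝟙 Vector.∷ const 𝟘)) ∎
          where
          open ≡-Reasoning
          c = combination (f ∘ suc) U
          c∈Fᵉ : ∀ d → InPow 𝔽 F (suc e) (c d)
          c∈Fᵉ = combination-∈ (f ∘ suc) (λ l → f∈F (suc l) z<s)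
          level-substitute : level U′ zero f ≗ substitute template (𝟙 Vector.∷ c)
          level-substitute i = trans (cong (apex i ⊕_) (trans (combination-tail f U′ (f≡𝟘 zero z≤n) i)
                                                              (combination-embed shift (f ∘ suc) U i)))
                                     (sym (substitute-𝟙∷ c i))
        coloured (suc j) f (f∈F , f≡𝟘) = trans (χ-cong level-tail) (level-coloured j (f ∘ suc) admissible)
          where
          level-tail : level U′ (suc j) f ≗ lift (level U j (f ∘ suc))
          level-tail i = trans (cong (lift (U j) i ⊕_) (combination-tail f U′ (f≡𝟘 zero z≤n) i))
                               (level-embed shift U j (f ∘ suc) i)
          admissible : Admissible j (f ∘ suc)
          admissible = (λ l j<l → f∈F (suc l) (s≤s j<l)) , (λ l l≤j → f≡𝟘 (suc l) (s≤s l≤j))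

    module _ {s} (E : Enumeration s (_∈ F)) where
      HasMonochromaticS : ℕ → ℕ → ℕ → Set
      HasMonochromaticS n T R = ∀ (q : Vector ℕ R) → total q ≤ T →
                                (χ : Vector Carrier n → Fin R) → χ Preserves _≗_ ⟶ _≡_ →
                                ∃[ κ ] MonochromaticS χ (suc T) κ (q κ)

      hasMonochromaticS-zero : ∀ R → HasMonochromaticS 1 0 R
      hasMonochromaticS-zero R q total≤0 χ χ-cong =
        χ u , subst (MonochromaticS χ 1 (χ u)) (sym (n≤0⇒n≡0 (≤-trans (lookup≤total q (χ u)) total≤0)))
                    (MonochromaticS-singleton χ-cong u (λ _ → InPow-𝟙 0) (zero , 𝟙≢𝟘))
        where
        u : Vector Carrier 1
        u = const 𝟙

      -- Colour focusing: the induction on the blocks after the first runs with the quota of κ₀ = χ apex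
      -- lowered; if it returns κ₀, the apex extends the copy of S it finds, otherwise that copy is lifted.
      hasMonochromaticS-suc : ∀ {n T R} → HasMonochromaticS n T R →
                              HasMonochromaticS (mdhjNumber (s ^ suc T) (suc n) R) (suc T) R
      hasMonochromaticS-suc {n} {T} {R} ih q total≤ χ χ-cong = byQuota (q κ₀) refl
        where
        open Apex (multidimensionalHalesJewett (enumerate-InPow E (suc T)) (suc n) R χ χ-cong)
        κ₀ = χ apex
        grow : ∀ {p} → q κ₀ ≡ suc p → ∃[ κ ] MonochromaticS χ (suc (suc T)) κ (q κ)
        grow {p} qκ₀≡ with ih q′ (s≤s⁻¹ (subst (_≤ suc T) (total-updateAt-pred q κ₀ qκ₀≡) total≤))
                              (χ ∘ lift) (χ-cong ∘ embed-cong shift)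
          where q′ = updateAt q κ₀ pred
        ... | κ , M with κ Fin.≟ κ₀
        ...   | yes refl = κ₀ , subst (MonochromaticS χ _ κ₀) (sym qκ₀≡) (MonochromaticS-extend χ-cong M′)
          where
          M′ : MonochromaticS (χ ∘ lift) (suc T) κ₀ p
          M′ = subst (MonochromaticS (χ ∘ lift) _ κ₀) (trans (updateAt-updates κ₀ q) (cong pred qκ₀≡)) M
        ...   | no  κ≢κ₀ = κ , MonochromaticS-raise (MonochromaticS-pullback shift lift-onto χ-cong M′)
          where
          M′ : MonochromaticS (χ ∘ lift) (suc T) κ (q κ)
          M′ = subst (MonochromaticS (χ ∘ lift) _ κ) (updateAt-minimal κ κ₀ q κ≢κ₀) M
        byQuota : ∀ p → q κ₀ ≡ p → ∃[ κ ] MonochromaticS χ (suc (suc T)) κ (q κ)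
        byQuota zero    qκ₀≡0 = κ₀ , subst (MonochromaticS χ _ κ₀) (sym qκ₀≡0)
                                           (MonochromaticS-singleton χ-cong apex apex-∈ apex-nonzero)
        byQuota (suc p) qκ₀≡  = grow qκ₀≡

      monochromaticS : ∀ T R → HasMonochromaticS (monochromaticSNumber s T R) T R
      monochromaticS zero    R = hasMonochromaticS-zero R
      monochromaticS (suc T) R = hasMonochromaticS-suc (monochromaticS T R)

    module _ {k r} (t : Vector Carrier k) (c : Carrier → Fin r) where
      -- U zero would be a nonzero vector of coefficients in Fᵉ′ annihilating t.
      zero-colour-independent : ∀ {e e′} → Independent 𝔽 (InPow 𝔽 F e′) k t → e ≤′ e′ →
                                ¬ MonochromaticS (colour₀ c ∘ evaluate t) e zero 0
      zero-colour-independent {e} independent e≤e′ M =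
        proj₂ (nonzero zero) (independent (U zero) U∈Fᵉ′ (trans (Σ[<]-sum k _) U-annihilates) _)
        where
        open MonochromaticS M
        U∈Fᵉ′ : ∀ i → InPow 𝔽 F _ (U zero i)
        U∈Fᵉ′ i = InPow-mono e≤e′ (subst (InPow 𝔽 F e) (trans (+-identityʳ _) (*-identityˡ _))
                                         (combination-∈ (const 𝟙) (const 1∈F) i))
        U-annihilates : evaluate t (U zero) ≡ 𝟘
        U-annihilates = colour₀-zero c _ (trans (cong (colour₀ c) (evaluate-cong t level-𝟘))
                                              (level-coloured zero (const 𝟘) ((λ _ _ → 0∈F) , (λ _ _ → refl))))
          where
          level-𝟘 : U zero ≗ level U zero (const 𝟘)
          level-𝟘 i = sym (trans (cong (U zero i ⊕_) (combination-𝟘 U i)) (+-identityʳ _))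

      MonochromaticS-InS : ∀ {e κ p} (M : MonochromaticS (colour₀ c ∘ evaluate t) e (suc κ) p) →
                           Monochromatic 𝔽 c (InS 𝔽 (suc p) F (evaluate t ∘ MonochromaticS.U M))
      MonochromaticS-InS {κ = κ} {p} M = κ , λ { x (j , f , f∈F , f≡𝟘 , x≡) → colour₀-suc c x (begin
        colour₀ c x                          ≡⟨ cong (colour₀ c) (trans x≡ (evaluate-level′ j f)) ⟩
        colour₀ c (evaluate t (level U j f)) ≡⟨ level-coloured j f (f∈F , f≡𝟘) ⟩
        suc κ                                ∎) }
        where
        open MonochromaticS M
        open ≡-Reasoning
        evaluate-level′ : ∀ j f → evaluate t (U j) ⊕ Σ[<_]_ 𝔽 (suc p) (λ l → f l · evaluate t (U l))
                                ≡ evaluate t (level U j f)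
        evaluate-level′ j f = trans (cong (evaluate t (U j) ⊕_) (Σ[<]-sum (suc p) (λ l → f l · evaluate t (U l))))
                                    (sym (evaluate-level t U j f))

    -- Colour zero is reserved for the value 𝟘 and gets quota 0, so that a single vector suffices for the
    -- contradiction and the exponent stays at r (m - 1) + 1 ≤ m r.
    S-monochromatic : ∀ {k s} m r (c : Carrier → Fin (suc r)) (t : Vector Carrier k) → length F ≤ s →
                      Independent 𝔽 (InPow 𝔽 F (suc m * suc r)) k t →
                      monochromaticSNumber s (suc r * m) (suc (suc r)) ≤ k →
                      Σ[ t′ ∈ Vector Carrier (suc m) ] Monochromatic 𝔽 c (InS 𝔽 (suc m) F t′)
    S-monochromatic {k} {s} m r c t |F|≤s independent n≤k =
      conclude (monochromaticS (enumerate-∈ 0∈F |F|≤s) T (suc (suc r)) quota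
                               (≤-reflexive (total-const (suc r) m)) (χ ∘ embed π) (χ-cong ∘ embed-cong π))
      where
      T = suc r * m
      quota : Vector ℕ (suc (suc r))
      quota = 0 Vector.∷ const m
      χ : Vector Carrier k → Fin (suc (suc r))
      χ = colour₀ c ∘ evaluate t
      χ-cong : χ Preserves _≗_ ⟶ _≡_
      χ-cong = cong (colour₀ c) ∘ evaluate-cong t
      π = inject≤⁻¹ (monochromaticSNumber s T (suc (suc r)))
      onto : ∀ i′ → ∃[ i ] π i ≡ just i′
      onto i′ = inject≤ i′ n≤k , inject≤⁻¹-inject≤ i′ n≤k
      exponent : suc T ≤′ suc m * suc r
      exponent = ≤⇒≤′ (subst (λ x → suc x ≤ suc m * suc r) (*-comm m (suc r))
                             (+-monoˡ-≤ (m * suc r) (s≤s z≤n)))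
      conclude : ∃[ κ ] MonochromaticS (χ ∘ embed π) (suc T) κ (quota κ) →
                 Σ[ t′ ∈ Vector Carrier (suc m) ] Monochromatic 𝔽 c (InS 𝔽 (suc m) F t′)
      conclude (zero  , M) = contradiction (MonochromaticS-pullback π onto χ-cong M)
                                           (zero-colour-independent t c independent exponent)
      conclude (suc κ , M) = evaluate t ∘ MonochromaticS.U M′ , MonochromaticS-InS t c M′
        where M′ = MonochromaticS-pullback π onto χ-cong M

Ψ : ℕ → ℕ → ℕ → ℕ
Ψ m r s = suc (monochromaticSNumber s (r * pred m) (suc r))

proposition2p7 :
    Σ[ Ψ ∈ (ℕ → ℕ → ℕ → ℕ) ] ((∀ m r s → NonZero m → NonZero r → NonZero s → NonZero (Ψ m r s))
      × (∀ m r s → NonZero m → NonZero r → NonZero s →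
         (𝔽 : FiniteField) → (k : ℕ) →
         (F : List (FiniteField.Carrier 𝔽)) → Unique F →
         FiniteField.𝟘 𝔽 ∈ F → FiniteField.𝟙 𝔽 ∈ F → length F ≤ s →
         (c : FiniteField.Carrier 𝔽 → Fin r) →
         (t : Fin k → FiniteField.Carrier 𝔽) →
         Independent 𝔽 (InPow 𝔽 F (m * r)) k t →
         k ≥ Ψ m r s →
         Σ[ t' ∈ (Fin m → FiniteField.Carrier 𝔽) ] Monochromatic 𝔽 c (InS 𝔽 m F t')))
proposition2p7 = Ψ , (λ _ _ _ _ _ _ → _) , λ where
  (suc m) (suc r) s _ _ _ 𝔽 k F _ 0∈F 1∈F |F|≤s c t independent k≥Ψ →
    S-monochromatic 𝔽 0∈F 1∈F m r c t |F|≤s independent (≤-trans (n≤1+n _) k≥Ψ)
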